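{- Let $C$ be a configuration and let $s$ be a clearing sequence of $C$ with final square $f$. Then: (1) the virtual $0$-pieces (with respect to $s$) induce a connected subgraph of the capture graph of $C$; (2) every vertex cut of the capture graph of $C$ contains a virtual $0$-piece; (3) for every set $X$ of virtual $0$-pieces that does not contain the piece originally standing on $f$, the number of virtual $2$-pieces in the neighborhood $N(X)$ of $X$ in the capture graph is at least $|X|$.
   Context: A configuration is a finite set of pieces on distinct squares of a board, where either all pieces are kings or all pieces are knights, and each piece has a budget in $\{0,1,2\}$. A move: a piece with positive budget captures a piece it attacks (a king attacks squares $(x',y')$ with $\max(|x-x'|,|y-y'|)=1$ from $(x,y)$; a knight attacks squares with $\{|x-x'|,|y-y'|\}=\{1,2\}$), moving to the captured piece's square, removing it, and losing 1 budget. A capturing sequence clears $C$ if exactly one piece remains afterwards; the square of that piece is the final square. The capture graph of $C$ has the pieces as vertices, two pieces being adjacent iff they attack each other (ignoring budgets). With respect to a capturing sequence $s$, a virtual $0$-piece is a piece that never moves from its original square during $s$; all other pieces are virtual $2$-pieces. The neighborhood $N(X)$ of a vertex set $X$ is the set of vertices outside $X$ adjacent to some vertex of $X$; a vertex cut is a set of vertices whose removal disconnects the graph. -}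

module Defs where

open import Data.Bool using (Bool; true; false; if_then_else_)
open import Data.Nat using (ℕ; _≤_; _∸_; _⊔_)
open import Data.Nat as ℕ using ()
open import Data.Integer using (ℤ; _-_; ∣_∣)
import Data.Integer as ℤ
open import Data.Fin using (Fin)
import Data.Fin as Fin
open import Data.Fin.Subset using (Subset; _∈_; _∉_)
open import Data.Fin.Subset.Properties using (_∈?_)
open import Data.Fin.Properties using (any?)
open import Data.Vec using (tabulate)
open import Data.List using (List; []; _∷_)
open import Data.List.Relation.Unary.All using (All)
open import Data.List.Relation.Unary.All using () renaming (all? to All-all?)
open import Data.Product using (Σ; ∃; _×_; _,_)
open import Data.Product.Properties using (≡-dec)
open import Data.Sum using (_⊎_)
open import Relation.Nullary using (¬_; Dec; does; ¬?)
open import Relation.Nullary.Decidable using (_×-dec_; _⊎-dec_)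
open import Relation.Binary.PropositionalEquality using (_≡_; _≢_)

Square : Set
Square = ℤ × ℤ

data Kind : Set where
  king knight : Kind

Attacks : Kind → Square → Square → Set
Attacks king (x , y) (x' , y') = ∣ x - x' ∣ ⊔ ∣ y - y' ∣ ≡ 1
Attacks knight (x , y) (x' , y') =
  (∣ x - x' ∣ ≡ 1 × ∣ y - y' ∣ ≡ 2) ⊎ (∣ x - x' ∣ ≡ 2 × ∣ y - y' ∣ ≡ 1)

attacks? : (k : Kind) (a b : Square) → Dec (Attacks k a b)
attacks? king (x , y) (x' , y') = (∣ x - x' ∣ ⊔ ∣ y - y' ∣) ℕ.≟ 1
attacks? knight (x , y) (x' , y') =
  ((∣ x - x' ∣ ℕ.≟ 1) ×-dec (∣ y - y' ∣ ℕ.≟ 2))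
  ⊎-dec ((∣ x - x' ∣ ℕ.≟ 2) ×-dec (∣ y - y' ∣ ℕ.≟ 1))

record Config (n : ℕ) : Set where
  field
    kind     : Kind
    pos      : Fin n → Square
    budget   : Fin n → ℕ
    distinct : ∀ i j → pos i ≡ pos j → i ≡ j
    budget≤2 : ∀ i → budget i ≤ 2
open Config public

record State (n : ℕ) : Set where
  field
    alive  : Fin n → Bool
    cur    : Fin n → Square
    budg   : Fin n → ℕ
open State public

initial : ∀ {n} → Config n → State n
initial C = record { alive = λ _ → true ; cur = pos C ; budg = budget C }

-- A move (i , j): piece i captures piece j
Move : ℕ → Set
Move n = Fin n × Fin n

ValidMove : ∀ {n} → Kind → State n → Fin n → Fin n → Set
ValidMove k σ i j =
  alive σ i ≡ true × alive σ j ≡ true × i ≢ j × 1 ≤ budg σ i × Attacks k (cur σ i) (cur σ j)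

apply : ∀ {n} → State n → Fin n → Fin n → State n
apply σ i j = record
  { alive = λ x → if does (x Fin.≟ j) then false else alive σ x
  ; cur   = λ x → if does (x Fin.≟ i) then cur σ j else cur σ x
  ; budg  = λ x → if does (x Fin.≟ i) then budg σ i ∸ 1 else budg σ x
  }

data Run {n : ℕ} (k : Kind) : State n → List (Move n) → State n → Set where
  done : ∀ {σ} → Run k σ [] σ
  step : ∀ {σ τ i j ms} → ValidMove k σ i j → Run k (apply σ i j) ms τ →
         Run k σ ((i , j) ∷ ms) τ

trace : ∀ {n} → State n → List (Move n) → List (State n)
trace σ [] = σ ∷ []
trace σ ((i , j) ∷ ms) = σ ∷ trace (apply σ i j) ms

ClearsWithFinal : ∀ {n} → Config n → List (Move n) → Square → Set
ClearsWithFinal {n} C s f =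
  Σ (State n) λ τ → Run (kind C) (initial C) s τ ×
    Σ (Fin n) λ w → alive τ w ≡ true × (∀ j → alive τ j ≡ true → j ≡ w) × cur τ w ≡ f

-- virtual 0-piece w.r.t. s: never moves from its original square during s
Virtual0 : ∀ {n} → Config n → List (Move n) → Fin n → Set
Virtual0 C s i = All (λ σ → cur σ i ≡ pos C i) (trace (initial C) s)

virtual0? : ∀ {n} (C : Config n) (s : List (Move n)) (i : Fin n) → Dec (Virtual0 C s i)
virtual0? C s i = All-all? (λ σ → ≡-dec ℤ._≟_ ℤ._≟_ (cur σ i) (pos C i)) (trace (initial C) s)

-- capture graph: adjacency = the two pieces attack each other
Adj : ∀ {n} → Config n → Fin n → Fin n → Set
Adj C i j = Attacks (kind C) (pos C i) (pos C j) × Attacks (kind C) (pos C j) (pos C i)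

adj? : ∀ {n} (C : Config n) i j → Dec (Adj C i j)
adj? C i j = attacks? (kind C) (pos C i) (pos C j) ×-dec attacks? (kind C) (pos C j) (pos C i)

data Path {n : ℕ} (C : Config n) (P : Fin n → Set) : Fin n → Fin n → Set where
  here  : ∀ {u} → P u → Path C P u u
  there : ∀ {u v w} → P u → Adj C u v → Path C P v w → Path C P u w

IsVertexCut : ∀ {n} → Config n → Subset n → Set
IsVertexCut C S = ∃ λ u → ∃ λ v → u ∉ S × v ∉ S × ¬ Path C (λ w → w ∉ S) u v

-- virtual 2-pieces in the neighbourhood N(X) of X in the capture graph
N₂ : ∀ {n} → Config n → List (Move n) → Subset n → Subset n
N₂ C s X = tabulate λ v →
  does (¬? (v ∈? X) ×-dec (any? (λ x → (x ∈? X) ×-dec adj? C x v) ×-dec ¬? (virtual0? C s v)))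

{-# OPTIONS --safe #-}
module Submission where

-- If its first move is i capturing j, then j
-- never moves again, and in every later state i stands on j's old square, so sending
-- i to j maps paths of the later capture graphs into the current one. Hence any set of
-- living pieces containing all pieces that never move again is connected; this gives
-- (1), and applied to the complement of a cut avoiding all virtual 0-pieces, (2).
-- For (3): a piece y of X is not on f, so some i captures it. Either i moves again,
-- and then y's square is the first target of a piece moving twice, or the square
-- (now occupied by i) is, inductively, the first target of a piece r moving twice;
-- r is not i, since i has at most one move left. Such an r is a virtual 2-piece
-- adjacent to y, and its first target determines y.

open import Defs
open import Data.Bool using (true; false; if_then_else_)
open import Data.Nat using (ℕ; zero; suc; _≤_; _∸_; z≤n; s≤s)
import Data.Nat.Properties as ℕ
open import Data.Integer.Properties using (∣i-j∣≡∣j-i∣; i≡j⇒i-j≡0)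
open import Data.Fin using (Fin; zero; suc; _≟_)
open import Data.Fin.Subset using (Subset; _∈_; _∉_; ∣_∣; inside; outside; _-_; ⁅_⁆)
open import Data.Fin.Subset.Properties
  using (_∈?_; x∈p∧x≢y⇒x∈p-y; x∈p⇒∣p-x∣<∣p∣; p─q⊆p; p─⊥≡p; nonempty?; Empty-unique; ∣⊥∣≡0)
open import Data.Fin.Properties using (any?)
open import Data.Vec using (_∷_; here; there)
open import Data.Vec.Properties using (lookup∘tabulate; lookup⇒[]=)
open import Data.List using (List; []; _∷_)
open import Data.List.Relation.Unary.All using (All; []; _∷_)
open import Data.Maybe using (Maybe; just; nothing)
open import Data.Maybe.Properties using (just-injective)
open import Data.Product using (_×_; ∃; _,_; proj₁; proj₂; swap)
open import Data.Sum using (_⊎_; inj₁; inj₂; [_,_]′; map₂)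
open import Relation.Nullary using (¬_; yes; no; does; contradiction)
open import Relation.Nullary.Decidable using (dec-true; dec-false; _×-dec_; ¬?)
open import Relation.Binary.PropositionalEquality
open import Function using (_∘_)

module _ {a} {A : Set a} {n : ℕ} {a₁ a₂ : A} where
  if-≟-refl : ∀ (x : Fin n) → (if does (x ≟ x) then a₁ else a₂) ≡ a₁
  if-≟-refl x rewrite dec-true (x ≟ x) refl = refl

  if-≟-≢ : ∀ {x y : Fin n} → x ≢ y → (if does (x ≟ y) then a₁ else a₂) ≡ a₂
  if-≟-≢ {x} {y} x≢y rewrite dec-false (x ≟ y) x≢y = refl

module _ {n : ℕ} (σ : State n) (i j : Fin n) where
  cur-apply-≡ : cur (apply σ i j) i ≡ cur σ j
  cur-apply-≡ = if-≟-refl i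

  cur-apply-≢ : ∀ {x} → x ≢ i → cur (apply σ i j) x ≡ cur σ x
  cur-apply-≢ = if-≟-≢

  budg-apply-≡ : budg (apply σ i j) i ≡ budg σ i ∸ 1
  budg-apply-≡ = if-≟-refl i

  budg-apply-≤ : ∀ {x} → budg (apply σ i j) x ≤ budg σ x
  budg-apply-≤ {x} with x ≟ i
  ... | yes refl = ℕ.m∸n≤m (budg σ i) 1
  ... | no _ = ℕ.≤-refl

  budg≤-apply : ∀ {b} → (∀ x → budg σ x ≤ b) → ∀ x → budg (apply σ i j) x ≤ b
  budg≤-apply budg≤b x = ℕ.≤-trans budg-apply-≤ (budg≤b x)

  alive-apply-≡ : alive (apply σ i j) j ≡ false
  alive-apply-≡ = if-≟-refl j

  alive-apply-≢ : ∀ {x} → x ≢ j → alive (apply σ i j) x ≡ alive σ x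
  alive-apply-≢ = if-≟-≢

  alive-apply⇒alive : ∀ {x} → alive (apply σ i j) x ≡ true → alive σ x ≡ true
  alive-apply⇒alive {x} al with x ≟ j
  ... | no _ = al

  dead-apply : ∀ {x} → alive σ x ≡ false → alive (apply σ i j) x ≡ false
  dead-apply {x} dead with x ≟ j
  ... | yes _ = refl
  ... | no _ = dead

attacks-sym : ∀ k {a b} → Attacks k a b → Attacks k b a
attacks-sym king {x , y} {x' , y'} rewrite ∣i-j∣≡∣j-i∣ x x' | ∣i-j∣≡∣j-i∣ y y' = λ h → h
attacks-sym knight {x , y} {x' , y'} rewrite ∣i-j∣≡∣j-i∣ x x' | ∣i-j∣≡∣j-i∣ y y' = λ h → h

attacks-irrefl : ∀ k {a} → ¬ Attacks k a a
attacks-irrefl king {x , y} rewrite i≡j⇒i-j≡0 {x} refl | i≡j⇒i-j≡0 {y} refl = λ ()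
attacks-irrefl knight {x , y} rewrite i≡j⇒i-j≡0 {x} refl | i≡j⇒i-j≡0 {y} refl =
  λ { (inj₁ (() , _)) ; (inj₂ (() , _)) }

attacks⇒≢ : ∀ k {a b} → Attacks k a b → a ≢ b
attacks⇒≢ k att refl = attacks-irrefl k att

AdjAt : ∀ {n} → Kind → (Fin n → Square) → Fin n → Fin n → Set
AdjAt k q u v = Attacks k (q u) (q v) × Attacks k (q v) (q u)

data PathAt {n : ℕ} (k : Kind) (q : Fin n → Square) (P : Fin n → Set) : Fin n → Fin n → Set where
  here  : ∀ {u} → P u → PathAt k q P u u
  there : ∀ {u v w} → P u → AdjAt k q u v → PathAt k q P v w → PathAt k q P u w

module _ {n : ℕ} {k : Kind} {q : Fin n → Square} {P : Fin n → Set} where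
  PathAt-start : ∀ {u v} → PathAt k q P u v → P u
  PathAt-start (here p) = p
  PathAt-start (there p _ _) = p

  PathAt-trans : ∀ {u v w} → PathAt k q P u v → PathAt k q P v w → PathAt k q P u w
  PathAt-trans (here _) r = r
  PathAt-trans (there p a r) r' = there p a (PathAt-trans r r')

  PathAt-sym : ∀ {u v} → PathAt k q P u v → PathAt k q P v u
  PathAt-sym (here p) = here p
  PathAt-sym (there p a r) = PathAt-trans (PathAt-sym r) (there (PathAt-start r) (swap a) (here p))

PathAt-map : ∀ {n k} {q q' : Fin n → Square} {P P' : Fin n → Set} (φ : Fin n → Fin n) →
  (∀ {x} → P' x → P (φ x)) → (∀ x → q' x ≡ q (φ x)) →
  ∀ {u v} → PathAt k q' P' u v → PathAt k q P (φ u) (φ v)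
PathAt-map φ φ-P φ-q (here p) = here (φ-P p)
PathAt-map {k = k} φ φ-P φ-q (there {u} {v} p (a , b) r) =
  there (φ-P p) (subst₂ (Attacks k) (φ-q u) (φ-q v) a , subst₂ (Attacks k) (φ-q v) (φ-q u) b)
        (PathAt-map φ φ-P φ-q r)

PathAt⇒Path : ∀ {n} (C : Config n) {P : Fin n → Set} {u v} →
  PathAt (kind C) (pos C) P u v → Path C P u v
PathAt⇒Path C (here p) = here p
PathAt⇒Path C (there p a r) = there p a (PathAt⇒Path C r)

StaysAt : ∀ {n} → Square → State n → List (Move n) → Fin n → Set
StaysAt c σ ms x = All (λ τ → cur τ x ≡ c) (trace σ ms)

Stays : ∀ {n} → State n → List (Move n) → Fin n → Set
Stays σ ms x = StaysAt (cur σ x) σ ms x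

stays-∷ : ∀ {n} {σ : State n} {i j x ms} →
  cur (apply σ i j) x ≡ cur σ x → Stays (apply σ i j) ms x → Stays σ ((i , j) ∷ ms) x
stays-∷ {σ = σ} {i} {j} {x} {ms} eq st = refl ∷ subst (λ c → StaysAt c (apply σ i j) ms x) eq st

All-trace-head : ∀ {n p} {P : State n → Set p} {σ} ms → All P (trace σ ms) → P σ
All-trace-head []      (p ∷ _) = p
All-trace-head (_ ∷ _) (p ∷ _) = p

dead⇒stays : ∀ {n k} {σ τ : State n} {ms x} → Run k σ ms τ → alive σ x ≡ false → Stays σ ms x
dead⇒stays done dead = refl ∷ []
dead⇒stays {σ = σ} {x = x} (step {i = i} {j} (alive-i , _) r) dead =
  stays-∷ (cur-apply-≢ σ i j x≢i) (dead⇒stays r (dead-apply σ i j dead))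
  where
  x≢i : x ≢ i
  x≢i refl = contradiction (trans (sym alive-i) dead) λ ()

stationary-connected : ∀ {n k} {σ τ : State n} {ms w} → Run k σ ms τ →
  (∀ y → alive τ y ≡ true → y ≡ w) →
  (P : Fin n → Set) → (∀ {x} → P x → alive σ x ≡ true) →
  (∀ {x} → alive σ x ≡ true → Stays σ ms x → P x) →
  ∀ {u v} → P u → P v → PathAt k (cur σ) P u v
stationary-connected done sole P P⇒alive _ {u} {v} pu pv
  with refl ← sole u (P⇒alive pu) | refl ← sole v (P⇒alive pv) = here pu
stationary-connected {n} {k} {σ} (step {i = i} {j} {ms} (alive-i , alive-j , i≢j , _ , att) r)
  sole P P⇒alive stationary⇒P pu pv = join (enter pu) (enter pv)
  where
  σ' = apply σ i j

  φ : Fin n → Fin n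
  φ x = if does (x ≟ i) then j else x

  φ-i : φ i ≡ j
  φ-i = if-≟-refl i

  cur-φ : ∀ x → cur σ' x ≡ cur σ (φ x)
  cur-φ x with x ≟ i
  ... | yes _ = refl
  ... | no _ = refl

  P' : Fin n → Set
  P' x = alive σ' x ≡ true × P (φ x)

  Pj : P j
  Pj = stationary⇒P alive-j
    (stays-∷ (cur-apply-≢ σ i j (i≢j ∘ sym)) (dead⇒stays {x = j} r (alive-apply-≡ σ i j)))

  P-φ : ∀ x → (x ≢ i → P x) → P (φ x)
  P-φ x P-x with x ≟ i
  ... | yes refl = Pj
  ... | no x≢i = P-x x≢i

  stationary⇒P' : ∀ {x} → alive σ' x ≡ true → Stays σ' ms x → P' x
  stationary⇒P' {x} al st =
    al , P-φ x λ x≢i →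
      stationary⇒P (alive-apply⇒alive σ i j al) (stays-∷ (cur-apply-≢ σ i j x≢i) st)

  P'-i : P' i
  P'-i = trans (alive-apply-≢ σ i j i≢j) alive-i , subst P (sym φ-i) Pj

  Entry : Fin n → Set
  Entry u = ∃ λ u' → P' u' × PathAt k (cur σ) P u (φ u')

  enter : ∀ {u} → P u → Entry u
  enter {u} pu with u ≟ i | u ≟ j
  ... | yes refl | _ =
    i , P'-i , subst (PathAt k (cur σ) P i) (sym φ-i) (there pu (att , attacks-sym k att) (here Pj))
  ... | no _ | yes refl = i , P'-i , subst (PathAt k (cur σ) P j) (sym φ-i) (here pu)
  ... | no u≢i | no u≢j =
    u , (trans (alive-apply-≢ σ i j u≢j) (P⇒alive pu) , P-φ u λ _ → pu) ,
    subst (PathAt k (cur σ) P u) (sym (if-≟-≢ u≢i)) (here pu)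

  join : ∀ {u v} → Entry u → Entry v → PathAt k (cur σ) P u v
  join (u' , pu' , u⇝φu') (v' , pv' , v⇝φv') =
    PathAt-trans u⇝φu'
      (PathAt-trans
        (PathAt-map φ proj₂ cur-φ (stationary-connected r sole P' proj₁ stationary⇒P' pu' pv'))
        (PathAt-sym v⇝φv'))

moves : ∀ {n} → List (Move n) → Fin n → ℕ
moves [] x = 0
moves ((i , _) ∷ ms) x = if does (x ≟ i) then suc (moves ms x) else moves ms x

firstTarget : ∀ {n} → State n → List (Move n) → Fin n → Maybe Square
firstTarget σ [] x = nothing
firstTarget σ ((i , j) ∷ ms) x =
  if does (x ≟ i) then just (cur σ j) else firstTarget (apply σ i j) ms x

moves≤budg : ∀ {n k} {σ τ : State n} {ms} → Run k σ ms τ → ∀ x → moves ms x ≤ budg σ x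
moves≤budg done x = z≤n
moves≤budg {σ = σ} (step {i = i} {j} {ms} (_ , _ , _ , 1≤budg , _) r) x with x ≟ i
... | yes refl = subst (_≤ budg σ i) (ℕ.+-comm (moves ms i) 1)
  (ℕ.m≤o∸n⇒m+n≤o (moves ms i) 1≤budg (subst (moves ms i ≤_) (budg-apply-≡ σ i j) (moves≤budg r i)))
... | no x≢i = ℕ.≤-trans (moves≤budg r x) (budg-apply-≤ σ i j)

moves⇒¬stays : ∀ {n k} {σ τ : State n} {ms x c} →
  Run k σ ms τ → 1 ≤ moves ms x → ¬ StaysAt c σ ms x
moves⇒¬stays {k = k} {σ} {ms = (i , j) ∷ ms} {x} (step (_ , _ , _ , _ , att) r) moved (stay ∷ st)
  with x ≟ i
... | yes refl =
  attacks⇒≢ k att (trans stay (trans (sym (All-trace-head ms st)) (cur-apply-≡ σ i j)))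
... | no _ = moves⇒¬stays r moved st

CoveredAt : ∀ {n} → Kind → State n → List (Move n) → Square → Set
CoveredAt {n} k σ ms c =
  ∃ λ (r : Fin n) → Attacks k (cur σ r) c × firstTarget σ ms r ≡ just c × 2 ≤ moves ms r

covered-∷ : ∀ {n k} {σ τ : State n} {i j ms c} → budg σ i ≤ 2 → Run k (apply σ i j) ms τ →
  CoveredAt k (apply σ i j) ms c → CoveredAt k σ ((i , j) ∷ ms) c
covered-∷ {k = k} {σ} {i = i} {j} {ms} {c} budg≤2 run (r , att , first , twice) =
  r , subst (λ a → Attacks k a c) (cur-apply-≢ σ i j r≢i) att ,
  trans (if-≟-≢ r≢i) first , subst (2 ≤_) (sym (if-≟-≢ r≢i)) twice
  where
  spent : moves ms i ≤ 1
  spent = ℕ.≤-trans (moves≤budg run i)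
            (subst (_≤ 1) (sym (budg-apply-≡ σ i j)) (ℕ.∸-monoˡ-≤ 1 budg≤2))
  r≢i : r ≢ i
  r≢i refl = ℕ.<⇒≱ twice spent

moves-or-covered : ∀ {n k} {σ τ : State n} {ms w} → Run k σ ms τ →
  (∀ y → alive τ y ≡ true → y ≡ w) → (∀ y → budg σ y ≤ 2) →
  ∀ {y} → alive σ y ≡ true → cur σ y ≢ cur τ w → 1 ≤ moves ms y ⊎ CoveredAt k σ ms (cur σ y)
moves-or-covered done sole _ {y} al off with refl ← sole y al = contradiction refl off
moves-or-covered {k = k} {σ} (step {i = i} {j} {ms} (alive-i , _ , i≢j , _ , att) r)
  sole budg≤2 {y} al off with y ≟ i | y ≟ j
... | yes refl | _ = inj₁ (s≤s z≤n)
... | no _ | yes refl =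
  inj₂ ([ (λ moved → i , att , if-≟-refl i , subst (2 ≤_) (sym (if-≟-refl i)) (s≤s moved))
        , covered-∷ (budg≤2 i) r ∘ subst (CoveredAt k (apply σ i j) ms) (cur-apply-≡ σ i j)
        ]′ (moves-or-covered r sole (budg≤-apply σ i j budg≤2)
              (trans (alive-apply-≢ σ i j i≢j) alive-i) (off ∘ trans (sym (cur-apply-≡ σ i j)))))
... | no y≢i | no y≢j =
  map₂ (covered-∷ (budg≤2 i) r ∘ subst (CoveredAt k (apply σ i j) ms) (cur-apply-≢ σ i j y≢i))
    (moves-or-covered r sole (budg≤-apply σ i j budg≤2) (trans (alive-apply-≢ σ i j y≢j) al)
       (off ∘ trans (sym (cur-apply-≢ σ i j y≢i))))

∣p∣≡1+∣p-x∣ : ∀ {n} {p : Subset n} {x} → x ∈ p → ∣ p ∣ ≡ suc ∣ p - x ∣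
∣p∣≡1+∣p-x∣ {p = inside ∷ p} here = cong (suc ∘ ∣_∣) (sym (p─⊥≡p p))
∣p∣≡1+∣p-x∣ {p = inside ∷ p} (there x∈p) = cong suc (∣p∣≡1+∣p-x∣ x∈p)
∣p∣≡1+∣p-x∣ {p = outside ∷ p} (there x∈p) = ∣p∣≡1+∣p-x∣ x∈p

x∉p-x : ∀ {n} {p : Subset n} x → x ∉ p - x
x∉p-x {p = _ ∷ _} zero ()
x∉p-x {p = _ ∷ _} (suc x) (there x∈p-x) = x∉p-x x x∈p-x

matching⇒∣p∣≤∣q∣ : ∀ {n} {p q : Subset n} (R : Fin n → Fin n → Set) →
  (∀ {x y r} → R x r → R y r → x ≡ y) → (∀ {x} → x ∈ p → ∃ λ r → r ∈ q × R x r) → ∣ p ∣ ≤ ∣ q ∣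
matching⇒∣p∣≤∣q∣ {n} R R-injective = go _ refl
  where
  go : ∀ k {p q : Subset n} → ∣ p ∣ ≡ k → (∀ {x} → x ∈ p → ∃ λ r → r ∈ q × R x r) → ∣ p ∣ ≤ ∣ q ∣
  go zero ∣p∣≡0 _ = subst (_≤ _) (sym ∣p∣≡0) z≤n
  go (suc k) {p} {q} ∣p∣≡1+k match with nonempty? p
  ... | no empty =
    contradiction (trans (sym ∣p∣≡1+k) (trans (cong ∣_∣ (Empty-unique empty)) (∣⊥∣≡0 n))) λ ()
  ... | yes (x , x∈p) with match x∈p
  ...   | r , r∈q , Rxr = begin
    ∣ p ∣          ≡⟨ ∣p∣≡1+∣p-x∣ x∈p ⟩
    suc ∣ p - x ∣  ≤⟨ s≤s (go k (ℕ.suc-injective (trans (sym (∣p∣≡1+∣p-x∣ x∈p)) ∣p∣≡1+k)) match') ⟩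
    suc ∣ q - r ∣  ≤⟨ x∈p⇒∣p-x∣<∣p∣ r∈q ⟩
    ∣ q ∣          ∎
    where
    open ℕ.≤-Reasoning
    match' : ∀ {y} → y ∈ p - x → ∃ λ r' → r' ∈ q - r × R y r'
    match' {y} y∈p-x with match (p─q⊆p p ⁅ x ⁆ y∈p-x)
    ... | r' , r'∈q , Ryr' = r' , x∈p∧x≢y⇒x∈p-y r'∈q r'≢r , Ryr'
      where
      r'≢r : r' ≢ r
      r'≢r refl = x∉p-x x (subst (_∈ p - x) (R-injective Ryr' Rxr) y∈p-x)

∈N₂ : ∀ {n} (C : Config n) (s : List (Move n)) (X : Subset n) {x v} →
  v ∉ X → x ∈ X → Adj C x v → ¬ Virtual0 C s v → v ∈ N₂ C s X
∈N₂ C s X {x} {v} v∉X x∈X adj ¬v0 =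
  lookup⇒[]= v _ (trans (lookup∘tabulate _ v)
    (dec-true (¬? (v ∈? X) ×-dec (any? (λ x → (x ∈? X) ×-dec adj? C x v) ×-dec ¬? (virtual0? C s v)))
      (v∉X , (x , x∈X , adj) , ¬v0)))

virtual0-connected : ∀ {n} (C : Config n) (s : List (Move n)) {f} → ClearsWithFinal C s f →
  ∀ u v → Virtual0 C s u → Virtual0 C s v → Path C (Virtual0 C s) u v
virtual0-connected C s (_ , run , _ , _ , sole , _) u v u∈V₀ v∈V₀ =
  PathAt⇒Path C (stationary-connected run sole (Virtual0 C s) (λ _ → refl) (λ _ v0 → v0) u∈V₀ v∈V₀)

vertexCut-meets-virtual0 : ∀ {n} (C : Config n) (s : List (Move n)) {f} → ClearsWithFinal C s f →
  ∀ S → IsVertexCut C S → ∃ λ x → x ∈ S × Virtual0 C s x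
vertexCut-meets-virtual0 C s (_ , run , _ , _ , sole , _) S (u , v , u∉S , v∉S , disconnected)
  with any? (λ x → (x ∈? S) ×-dec virtual0? C s x)
... | yes meets = meets
... | no misses = contradiction
  (PathAt⇒Path C (stationary-connected run sole (_∉ S) (λ _ → refl)
                   (λ {x} _ x∈V₀ x∈S → misses (x , x∈S , x∈V₀)) u∉S v∉S))
  disconnected

virtual0⇒∣X∣≤∣N₂X∣ : ∀ {n} (C : Config n) (s : List (Move n)) {f} → ClearsWithFinal C s f →
  ∀ X → (∀ x → x ∈ X → Virtual0 C s x) → (∀ p → pos C p ≡ f → p ∉ X) → ∣ X ∣ ≤ ∣ N₂ C s X ∣
virtual0⇒∣X∣≤∣N₂X∣ C s (_ , run , _ , _ , sole , final) X X⊆V₀ f∉X =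
  matching⇒∣p∣≤∣q∣ FirstCapture
    (λ e e' → distinct C _ _ (just-injective (trans (sym e) e'))) partner
  where
  FirstCapture : Fin _ → Fin _ → Set
  FirstCapture x r = firstTarget (initial C) s r ≡ just (pos C x)

  partner : ∀ {x} → x ∈ X → ∃ λ r → r ∈ N₂ C s X × FirstCapture x r
  partner {x} x∈X
    with moves-or-covered run sole (budget≤2 C) refl (λ e → f∉X x (trans e final) x∈X)
  ... | inj₁ moved = contradiction (X⊆V₀ x x∈X) (moves⇒¬stays run moved)
  ... | inj₂ (r , att , first , twice) =
    r , ∈N₂ C s X r∉X x∈X (attacks-sym _ att , att) r∉V₀ , first
    where
    r∉V₀ : ¬ Virtual0 C s r
    r∉V₀ = moves⇒¬stays run (ℕ.≤-trans (s≤s z≤n) twice)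
    r∉X : r ∉ X
    r∉X r∈X = r∉V₀ (X⊆V₀ r r∈X)

lemma2 : ∀ {n} (C : Config n) (s : List (Move n)) (f : Square) →
    ClearsWithFinal C s f →
    (∀ u v → Virtual0 C s u → Virtual0 C s v → Path C (Virtual0 C s) u v)
    × (∀ (S : Subset n) → IsVertexCut C S → ∃ λ x → x ∈ S × Virtual0 C s x)
    × (∀ (X : Subset n) → (∀ x → x ∈ X → Virtual0 C s x) →
         (∀ p → pos C p ≡ f → p ∉ X) →
         ∣ X ∣ ≤ ∣ N₂ C s X ∣)
lemma2 C s f clears =
    virtual0-connected C s clears
  , vertexCut-meets-virtual0 C s clears
  , virtual0⇒∣X∣≤∣N₂X∣ C s clears
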